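{- For every integer $q\ge 2$, the graph $\overline{KM_q}$ has a frozen $(2q+1)$-clique-partition.
   Context: For $q\ge 2$, $\overline{ME_q}$ is the graph with the $4q+2$ vertices $u_0,u_1,\dots,u_{q+1}$ and $v_{i1},v_{i2},v_{i3}$ ($i=1,\dots,q$), whose edges are: the edges of the Hamiltonian cycle $u_0,u_1,\dots,u_{q+1},v_{11},v_{12},v_{13},v_{21},v_{22},v_{23},\dots,v_{q1},v_{q2},v_{q3},u_0$; the edges $u_iv_{i2}$ for $i=1,\dots,q$; and the edges $v_{i1}v_{i3}$ for $i=1,\dots,q$. $\overline{KM_q}$ is obtained from $\overline{ME_q}$ by deleting the edges $u_1u_2,u_2u_3,\dots,u_{q-1}u_q$. A $k$-clique-partition is a partition of the vertex set into at most $k$ (ordered, possibly empty) cliques; it is frozen if every vertex $v$ has a non-neighbour in each of the $k$ cliques other than the one containing $v$. -}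

module Defs where

open import Data.Nat using (ℕ; zero; suc; _+_; _∸_; _≤_)
open import Data.Fin using (Fin)
open import Data.Product using (_×_; Σ; ∃; ∃-syntax; _,_)
open import Data.Sum using (_⊎_)
open import Relation.Nullary using (¬_)
open import Data.Empty using (⊥)
open import Relation.Binary.PropositionalEquality using (_≡_; _≢_)

data Vtx (q : ℕ) : Set where
  u : (i : ℕ) → i ≤ q + 1 → Vtx q
  v : (i j : ℕ) → 1 ≤ i → i ≤ q → 1 ≤ j → j ≤ 3 → Vtx q

-- Directed listing of the edges of ME_q-bar (each undirected edge listed once
-- in at least one orientation).
MEEdge : (q : ℕ) → Vtx q → Vtx q → Set
-- Hamiltonian-cycle edges u_i u_{i+1}
MEEdge q (u i _) (u j _) = j ≡ suc i
-- cycle edge u_{q+1} v_{11}; spoke edges u_i v_{i2}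
MEEdge q (u i _) (v a b _ _ _ _) = (i ≡ q + 1 × a ≡ 1 × b ≡ 1) ⊎ (i ≡ a × b ≡ 2)
-- cycle edge v_{q3} u_0
MEEdge q (v a b _ _ _ _) (u i _) = a ≡ q × b ≡ 3 × i ≡ 0
-- cycle edges v_{a1}v_{a2}, v_{a2}v_{a3}, v_{a3}v_{(a+1)1}; chord v_{a1}v_{a3}
MEEdge q (v a b _ _ _ _) (v c d _ _ _ _) =
    (c ≡ a × b ≡ 1 × d ≡ 2)
  ⊎ (c ≡ a × b ≡ 2 × d ≡ 3)
  ⊎ (c ≡ suc a × b ≡ 3 × d ≡ 1)
  ⊎ (c ≡ a × b ≡ 1 × d ≡ 3)

MEAdj : (q : ℕ) → Vtx q → Vtx q → Set
MEAdj q x y = MEEdge q x y ⊎ MEEdge q y x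

DelEdge : (q : ℕ) → Vtx q → Vtx q → Set
DelEdge q (u i _) (u j _) = 1 ≤ i × i ≤ q ∸ 1 × j ≡ suc i
DelEdge q _ _ = ⊥

KMAdj : (q : ℕ) → Vtx q → Vtx q → Set
KMAdj q x y = MEAdj q x y × ¬ (DelEdge q x y ⊎ DelEdge q y x)

-- A k-clique-partition of a graph (V, Adj): an assignment of each vertex to
-- one of k ordered (possibly empty) parts, each part being a clique.
IsCliquePartition : {V : Set} → (V → V → Set) → (k : ℕ) → (V → Fin k) → Set
IsCliquePartition {V} Adj k c = ∀ (x y : V) → x ≢ y → c x ≡ c y → Adj x y

IsFrozen : {V : Set} → (V → V → Set) → (k : ℕ) → (V → Fin k) → Set
IsFrozen {V} Adj k c = ∀ (x : V) (j : Fin k) → j ≢ c x → ∃[ y ] (c y ≡ j × ¬ Adj x y)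

HasFrozenCliquePartition : {V : Set} → (V → V → Set) → ℕ → Set
HasFrozenCliquePartition {V} Adj k =
  ∃[ c ] (IsCliquePartition Adj k c × IsFrozen Adj k c)

-- The 2q+1 parts are the edges of a perfect matching M of ME_q-bar, none of
-- which is deleted in KM_q-bar: the spokes u_i v_i2 and the cycle edges
-- u_{q+1} v_11, v_i3 v_{i+1,1} and v_q3 u_0. Removing M from ME_q-bar leaves
-- the path u_0 ... u_{q+1} and the triangles v_i1 v_i2 v_i3, and every edge
-- of M joins two different of these components. A vertex adjacent to both
-- ends of a pair other than its own would therefore share a component with
-- both ends, so each other pair contains a non-neighbour.
module Submission where

open import Defs
open import Data.Nat using (ℕ; zero; suc; _≤_; _<_; _+_; _*_; z≤n; s≤s; z<s; s<s⁻¹; s≤s⁻¹; _<?_; _≟_)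
open import Data.Nat.Properties using (≤-refl; ≤-trans; ≤-antisym; <⇒≤; ≮⇒≥; <-irrefl; ≤-irrelevant; m≤m+n; +-comm; +-suc; +-identityʳ; 1+n≢n)
open import Data.Fin using (Fin; zero; suc; toℕ; fromℕ<)
open import Data.Fin.Properties using (toℕ<n; toℕ-fromℕ<; fromℕ<-toℕ; +↔⊎)
open import Data.Product using (_×_; _,_; ∃-syntax)
open import Data.Sum using (_⊎_; inj₁; inj₂; [_,_]; swap; map)
open import Data.Empty using (⊥-elim)
open import Function using (_∘_; _↔_; Inverse; Injection)
open import Function.Properties.Inverse using (↔-sym; ↔⇒↣)
open import Relation.Nullary using (¬_; yes; no)
open import Relation.Binary using (Symmetric; DecidableEquality)
open import Relation.Binary.PropositionalEquality using (_≡_; _≢_; refl; sym; trans; cong; subst; subst₂)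

private variable
  V C D : Set
  Adj : V → V → Set
  k : ℕ

IsCliquePartition′ : (V → V → Set) → (V → C) → Set
IsCliquePartition′ {V} Adj c = ∀ (x y : V) → x ≢ y → c x ≡ c y → Adj x y

IsFrozen′ : (V → V → Set) → (V → C) → Set
IsFrozen′ {V} {C} Adj c = ∀ (x : V) (K : C) → K ≢ c x → ∃[ y ] (c y ≡ K × ¬ Adj x y)

relabel : C ↔ Fin k → (c : V → C) →
          IsCliquePartition′ Adj c → IsFrozen′ Adj c → HasFrozenCliquePartition Adj k
relabel {Adj = Adj} e c clique frozen = to ∘ c , to-clique , to-frozen
  where
    open Inverse e using (to; from; strictlyInverseˡ)

    to-clique : IsCliquePartition′ Adj (to ∘ c)
    to-clique x y x≢y eq = clique x y x≢y (Injection.injective (↔⇒↣ e) eq)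

    to-frozen : IsFrozen′ Adj (to ∘ c)
    to-frozen x j j≢ with frozen x (from j) (λ eq → j≢ (trans (sym (strictlyInverseˡ j)) (cong to eq)))
    ... | y , cy≡ , ¬adj = y , trans (cong to cy≡) (strictlyInverseˡ j) , ¬adj

record PairPartition (V C : Set) : Set where
  field
    part     : V → C
    fst snd  : C → V
    part-fst : ∀ K → part (fst K) ≡ K
    part-snd : ∀ K → part (snd K) ≡ K
    fst-or-snd : ∀ x → x ≡ fst (part x) ⊎ x ≡ snd (part x)

module _ (P : PairPartition V C) where
  open PairPartition P

  pair-members : ∀ {x K} → part x ≡ K → x ≡ fst K ⊎ x ≡ snd K
  pair-members {x} eq = subst (λ K → x ≡ fst K ⊎ x ≡ snd K) eq (fst-or-snd x)

  pairs-isCliquePartition : Symmetric Adj → (∀ K → Adj (fst K) (snd K)) → IsCliquePartition′ Adj part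
  pairs-isCliquePartition {Adj = Adj} adj-sym adj x y x≢y eq
    with pair-members {x} refl | pair-members {y} (sym eq)
  ... | inj₁ x≡ | inj₁ y≡ = ⊥-elim (x≢y (trans x≡ (sym y≡)))
  ... | inj₁ x≡ | inj₂ y≡ = subst₂ Adj (sym x≡) (sym y≡) (adj (part x))
  ... | inj₂ x≡ | inj₁ y≡ = subst₂ Adj (sym x≡) (sym y≡) (adj-sym (adj (part x)))
  ... | inj₂ x≡ | inj₂ y≡ = ⊥-elim (x≢y (trans x≡ (sym y≡)))

  module _ (component : V → D) (edge : ∀ {x y} → Adj x y → part x ≡ part y ⊎ component x ≡ component y) where

    ¬adjacent : ∀ {x y} → part y ≢ part x → component x ≢ component y → ¬ Adj x y
    ¬adjacent part≢ component≢ = [ part≢ ∘ sym , component≢ ] ∘ edge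

    pairs-isFrozen : DecidableEquality D → (∀ K → component (fst K) ≢ component (snd K)) → IsFrozen′ Adj part
    pairs-isFrozen _≟ᴰ_ split x K K≢ with component x ≟ᴰ component (fst K)
    ... | no ≢fst = fst K , part-fst K , ¬adjacent (K≢ ∘ trans (sym (part-fst K))) ≢fst
    ... | yes ≡fst = snd K , part-snd K , ¬adjacent (K≢ ∘ trans (sym (part-snd K))) (split K ∘ trans (sym ≡fst))

module _ {q : ℕ} where

  u-cong : ∀ {i j} {hi : i ≤ q + 1} {hj : j ≤ q + 1} → i ≡ j → u {q} i hi ≡ u j hj
  u-cong {hi = hi} {hj} refl = cong (u _) (≤-irrelevant hi hj)

  v-cong : ∀ {a a' b b'} {ha₁ ha₂ hb₁ hb₂ ha₁' ha₂' hb₁' hb₂'} → a ≡ a' → b ≡ b' →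
           v {q} a b ha₁ ha₂ hb₁ hb₂ ≡ v a' b' ha₁' ha₂' hb₁' hb₂'
  v-cong {ha₁ = ha₁} {ha₂} {hb₁} {hb₂} {ha₁'} {ha₂'} {hb₁'} {hb₂'} refl refl
    rewrite ≤-irrelevant ha₁ ha₁' | ≤-irrelevant ha₂ ha₂' | ≤-irrelevant hb₁ hb₁' | ≤-irrelevant hb₂ hb₂' = refl

  component : Vtx q → ℕ
  component (u _ _) = 0
  component (v a _ _ _ _ _) = a

  KMAdj-sym : Symmetric (KMAdj q)
  KMAdj-sym (edge , ¬deleted) = swap edge , ¬deleted ∘ swap

pattern spoke i = inj₁ i
pattern link l = inj₂ l

module Matching (p : ℕ) where
  private
    q : ℕ
    q = suc p

  Pair : Set
  Pair = Fin q ⊎ Fin (suc q)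

  -- spoke i = {u_{i+1}, v_{i+1,2}}; link zero = {v_q3, u_0} and
  -- link (suc i) = {v_i3, v_{i+1,1}}, reading v_03 as u_{q+1}.
  fst : Pair → Vtx q
  fst (spoke i) = u (suc (toℕ i)) (≤-trans (toℕ<n i) (m≤m+n q 1))
  fst (link zero) = v q 3 z<s ≤-refl z<s ≤-refl
  fst (link (suc zero)) = u (q + 1) ≤-refl
  fst (link (suc (suc i))) = v (suc (toℕ i)) 3 z<s (s≤s (<⇒≤ (toℕ<n i))) z<s ≤-refl

  snd : Pair → Vtx q
  snd (spoke i) = v (suc (toℕ i)) 2 z<s (toℕ<n i) z<s (s≤s z<s)
  snd (link zero) = u 0 z≤n
  snd (link (suc i)) = v (suc (toℕ i)) 1 z<s (toℕ<n i) z<s z<s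

  u-part : ℕ → Pair
  u-part zero = link zero
  u-part (suc k) with k <? q
  ... | yes k<q = spoke (fromℕ< k<q)
  ... | no _ = link (suc zero)

  v₃-part : ℕ → Pair
  v₃-part k with suc k <? q
  ... | yes k+1<q = link (suc (suc (fromℕ< (s<s⁻¹ k+1<q))))
  ... | no _ = link zero

  part : Vtx q → Pair
  part (u i _) = u-part i
  part (v zero _ () _ _ _)
  part (v (suc k) zero _ _ () _)
  part (v (suc k) 1 _ k<q _ _) = link (suc (fromℕ< k<q))
  part (v (suc k) 2 _ k<q _ _) = spoke (fromℕ< k<q)
  part (v (suc k) 3 _ _ _ _) = v₃-part k
  part (v (suc k) (suc (suc (suc (suc _)))) _ _ _ (s≤s (s≤s (s≤s ()))))

  u-part-spoke : ∀ {k} (k<q : k < q) → u-part (suc k) ≡ spoke (fromℕ< k<q)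
  u-part-spoke {k} k<q with k <? q
  ... | yes _ = refl
  ... | no k≮q = ⊥-elim (k≮q k<q)

  u-part-last : u-part (q + 1) ≡ link (suc zero)
  u-part-last with p + 1 <? q
  ... | yes p+1<q = ⊥-elim (<-irrefl (+-comm p 1) p+1<q)
  ... | no _ = refl

  v₃-part-link : ∀ {k} (k+1<q : suc k < q) → v₃-part k ≡ link (suc (suc (fromℕ< (s<s⁻¹ k+1<q))))
  v₃-part-link {k} k+1<q with suc k <? q
  ... | yes _ = refl
  ... | no k+1≮q = ⊥-elim (k+1≮q k+1<q)

  v₃-part-last : v₃-part p ≡ link zero
  v₃-part-last with q <? q
  ... | yes q<q = ⊥-elim (<-irrefl refl q<q)
  ... | no _ = refl

  part-fst : ∀ K → part (fst K) ≡ K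
  part-fst (spoke i) = trans (u-part-spoke (toℕ<n i)) (cong spoke (fromℕ<-toℕ i _))
  part-fst (link zero) = v₃-part-last
  part-fst (link (suc zero)) = u-part-last
  part-fst (link (suc (suc i))) = trans (v₃-part-link (s≤s (toℕ<n i))) (cong (λ j → link (suc (suc j))) (fromℕ<-toℕ i _))

  part-snd : ∀ K → part (snd K) ≡ K
  part-snd (spoke i) = cong spoke (fromℕ<-toℕ i _)
  part-snd (link zero) = refl
  part-snd (link (suc i)) = cong (λ j → link (suc j)) (fromℕ<-toℕ i _)

  fst-or-snd : ∀ x → x ≡ fst (part x) ⊎ x ≡ snd (part x)
  fst-or-snd (u zero _) = inj₂ (u-cong refl)
  fst-or-snd (u (suc k) k+1≤q+1) with k <? q
  ... | yes k<q = inj₁ (u-cong (cong suc (sym (toℕ-fromℕ< k<q))))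
  ... | no k≮q = inj₁ (u-cong (cong suc (≤-antisym (s≤s⁻¹ k+1≤q+1) (subst (_≤ k) (+-comm 1 p) (≮⇒≥ k≮q)))))
  fst-or-snd (v zero _ () _ _ _)
  fst-or-snd (v (suc k) zero _ _ () _)
  fst-or-snd (v (suc k) 1 _ k<q _ _) = inj₂ (v-cong (cong suc (sym (toℕ-fromℕ< k<q))) refl)
  fst-or-snd (v (suc k) 2 _ k<q _ _) = inj₂ (v-cong (cong suc (sym (toℕ-fromℕ< k<q))) refl)
  fst-or-snd (v (suc k) 3 _ k<q _ _) with suc k <? q
  ... | yes k+1<q = inj₁ (v-cong (cong suc (sym (toℕ-fromℕ< (s<s⁻¹ k+1<q)))) refl)
  ... | no k+1≮q = inj₁ (v-cong (≤-antisym k<q (≮⇒≥ k+1≮q)) refl)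
  fst-or-snd (v (suc k) (suc (suc (suc (suc _)))) _ _ _ (s≤s (s≤s (s≤s ()))))

  pairs : PairPartition (Vtx q) Pair
  pairs = record
    { part = part ; fst = fst ; snd = snd
    ; part-fst = part-fst ; part-snd = part-snd ; fst-or-snd = fst-or-snd }

  pair-adjacent : ∀ K → KMAdj q (fst K) (snd K)
  pair-adjacent (spoke i) = inj₁ (inj₂ (refl , refl)) , λ { (inj₁ ()) ; (inj₂ ()) }
  pair-adjacent (link zero) = inj₁ (refl , refl , refl) , λ { (inj₁ ()) ; (inj₂ ()) }
  pair-adjacent (link (suc zero)) = inj₁ (inj₁ (refl , refl , refl)) , λ { (inj₁ ()) ; (inj₂ ()) }
  pair-adjacent (link (suc (suc i))) = inj₁ (inj₂ (inj₂ (inj₁ (refl , refl , refl)))) , λ { (inj₁ ()) ; (inj₂ ()) }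

  component-fst≢snd : ∀ K → component (fst K) ≢ component (snd K)
  component-fst≢snd (spoke i) = λ ()
  component-fst≢snd (link zero) = λ ()
  component-fst≢snd (link (suc zero)) = λ ()
  component-fst≢snd (link (suc (suc i))) = 1+n≢n ∘ sym

  MEEdge⇒same-part⊎same-component : ∀ x y → MEEdge q x y → part x ≡ part y ⊎ component x ≡ component y
  MEEdge⇒same-part⊎same-component (u _ _) (u _ _) _ = inj₂ refl
  MEEdge⇒same-part⊎same-component (u _ _) (v _ _ _ _ _ _) (inj₁ (refl , refl , refl)) = inj₁ u-part-last
  MEEdge⇒same-part⊎same-component (u _ _) (v zero _ () _ _ _) (inj₂ _)
  MEEdge⇒same-part⊎same-component (u _ _) (v (suc _) _ _ k<q _ _) (inj₂ (refl , refl)) = inj₁ (u-part-spoke k<q)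
  MEEdge⇒same-part⊎same-component (v zero _ () _ _ _) _ _
  MEEdge⇒same-part⊎same-component (v (suc _) _ _ _ _ _) (u _ _) (refl , refl , refl) = inj₁ v₃-part-last
  MEEdge⇒same-part⊎same-component (v (suc _) _ _ _ _ _) (v _ _ _ _ _ _) (inj₁ (refl , _)) = inj₂ refl
  MEEdge⇒same-part⊎same-component (v (suc _) _ _ _ _ _) (v _ _ _ _ _ _) (inj₂ (inj₁ (refl , _))) = inj₂ refl
  MEEdge⇒same-part⊎same-component (v (suc _) _ _ _ _ _) (v _ _ _ k+1<q _ _) (inj₂ (inj₂ (inj₁ (refl , refl , refl)))) =
    inj₁ (v₃-part-link k+1<q)
  MEEdge⇒same-part⊎same-component (v (suc _) _ _ _ _ _) (v _ _ _ _ _ _) (inj₂ (inj₂ (inj₂ (refl , _)))) = inj₂ refl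

  KMAdj⇒same-part⊎same-component : ∀ {x y} → KMAdj q x y → part x ≡ part y ⊎ component x ≡ component y
  KMAdj⇒same-part⊎same-component {x} {y} (inj₁ edge , _) = MEEdge⇒same-part⊎same-component x y edge
  KMAdj⇒same-part⊎same-component {x} {y} (inj₂ edge , _) = map sym sym (MEEdge⇒same-part⊎same-component y x edge)

  hasFrozenCliquePartition : HasFrozenCliquePartition (KMAdj q) (q + suc q)
  hasFrozenCliquePartition = relabel (↔-sym +↔⊎) part
    (pairs-isCliquePartition pairs KMAdj-sym pair-adjacent)
    (pairs-isFrozen pairs component KMAdj⇒same-part⊎same-component _≟_ component-fst≢snd)

theorem11 : (q : ℕ) → 2 ≤ q → HasFrozenCliquePartition (KMAdj q) (2 * q + 1)
theorem11 zero ()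
theorem11 (suc p) _ =
  subst (HasFrozenCliquePartition (KMAdj (suc p))) (q+[1+q]≡2q+1 (suc p)) (Matching.hasFrozenCliquePartition p)
  where
    q+[1+q]≡2q+1 : ∀ q → q + suc q ≡ 2 * q + 1
    q+[1+q]≡2q+1 q = trans (+-suc q q) (trans (cong (λ n → suc (q + n)) (sym (+-identityʳ q))) (+-comm 1 (2 * q)))
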